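{- Let $\{\mathcal{C}_k\}_{k>0}$ be a resource-indexed arboreal category and consider an idempotent resource-indexed arboreal adjunction $L_k\dashv R_k\colon\mathcal{E}\to\mathcal{C}_k$ ($k>0$). Then property (HP$^\#$) holds: for every $k>0$ and every full subcategory $\mathcal{D}$ of $\mathcal{E}$ that is saturated under $\cong_k$, $\mathcal{D}$ is closed under morphisms if and only if $\mathcal{D}$ is upwards closed with respect to $\to_k$.
   Context: Arboreal categories: categories (locally small, well-powered) with a stable proper factorisation system (quotients, embeddings) in which coproducts of sets of paths exist, every object is the colimit of its path embeddings, every path is connected, and for paths $P,Q,Q'$ if $P\to Q\to Q'$ is a quotient so is $P\to Q$; here a path is an object whose poset of embedding-subobjects is a finite chain. A resource-indexed arboreal category is an arboreal category $\mathcal{C}$ with an increasing chain $\mathcal{C}_p^1\subseteq\mathcal{C}_p^2\subseteq\cdots$ of full subcategories of paths, closed under embeddings and containing the initial object; $\mathcal{C}_k$ is the full subcategory of objects that are colimits of their path embeddings with domain in $\mathcal{C}_p^k$ (it is arboreal). A resource-indexed arboreal adjunction between $\mathcal{E}$ and $\mathcal{C}$ is a family of adjunctions $L_k\dashv R_k$, $L_k\colon\mathcal{C}_k\to\mathcal{E}$, $R_k\colon\mathcal{E}\to\mathcal{C}_k$; it is idempotent if each comonad $G_k=L_kR_k$ on $\mathcal{E}$ is idempotent (its comultiplication is a natural isomorphism). For $a,b\in\mathcal{E}$: $a\to_k b$ iff there is a morphism $R_ka\to R_kb$; $a\cong_k b$ iff $R_ka\cong R_kb$ in $\mathcal{C}_k$.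 A full subcategory $\mathcal{D}$ is closed under morphisms if $a\in\mathcal{D}$ and a morphism $a\to b$ in $\mathcal{E}$ imply $b\in\mathcal{D}$; it is saturated under (resp. upwards closed with respect to) a relation $\nabla$ if $a\in\mathcal{D}$ and $a\nabla b$ imply $b\in\mathcal{D}$. -}

module Defs where

open import Level using (Level; _⊔_) renaming (suc to lsuc)
open import Data.Nat using (ℕ; _≤_)
open import Data.Fin using (Fin)
open import Data.Unit.Polymorphic using (⊤)
open import Data.Product using (Σ; ∃; _×_; _,_; proj₁; proj₂)
open import Data.Sum using (_⊎_)
open import Relation.Binary using (Rel; IsEquivalence)
open import Relation.Binary.PropositionalEquality using (_≡_)
open import Function using (_⇔_)

record Category (o ℓ e : Level) : Set (lsuc (o ⊔ ℓ ⊔ e)) where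
  infixr 9 _∘_
  infix 4 _≈_
  infixr 5 _⇒_
  field
    Obj       : Set o
    _⇒_       : Obj → Obj → Set ℓ
    _≈_       : ∀ {A B} → Rel (A ⇒ B) e
    id        : ∀ {A} → A ⇒ A
    _∘_       : ∀ {A B C} → B ⇒ C → A ⇒ B → A ⇒ C
    equiv     : ∀ {A B} → IsEquivalence (_≈_ {A} {B})
    assoc     : ∀ {A B C D} {f : A ⇒ B} {g : B ⇒ C} {h : C ⇒ D} →
                (h ∘ g) ∘ f ≈ h ∘ (g ∘ f)
    identityˡ : ∀ {A B} {f : A ⇒ B} → id ∘ f ≈ f
    identityʳ : ∀ {A B} {f : A ⇒ B} → f ∘ id ≈ f
    ∘-resp-≈  : ∀ {A B C} {f h : B ⇒ C} {g i : A ⇒ B} →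
                f ≈ h → g ≈ i → f ∘ g ≈ h ∘ i

FullSub : ∀ {o ℓ e p} (C : Category o ℓ e) → (Category.Obj C → Set p) → Category (o ⊔ p) ℓ e
FullSub C P = record
  { Obj = Σ C.Obj P
  ; _⇒_ = λ A B → proj₁ A C.⇒ proj₁ B
  ; _≈_ = C._≈_
  ; id = C.id
  ; _∘_ = C._∘_
  ; equiv = C.equiv
  ; assoc = C.assoc
  ; identityˡ = C.identityˡ
  ; identityʳ = C.identityʳ
  ; ∘-resp-≈ = C.∘-resp-≈
  }
  where module C = Category C

module _ {o ℓ e} (C : Category o ℓ e) where
  private
    module C = Category C
  open C using (Obj; _⇒_; _≈_; _∘_; id)

  IsIsoMor : ∀ {A B} → A ⇒ B → Set (ℓ ⊔ e)
  IsIsoMor {A} {B} f = Σ (B ⇒ A) λ g → (g ∘ f ≈ id) × (f ∘ g ≈ id)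

  Iso : Obj → Obj → Set (ℓ ⊔ e)
  Iso A B = Σ (A ⇒ B) IsIsoMor

  Mono : ∀ {A B} → A ⇒ B → Set (o ⊔ ℓ ⊔ e)
  Mono {A} f = ∀ {Z} (g h : Z ⇒ A) → f ∘ g ≈ f ∘ h → g ≈ h

  Epi : ∀ {A B} → A ⇒ B → Set (o ⊔ ℓ ⊔ e)
  Epi {B = B} f = ∀ {Z} (g h : B ⇒ Z) → g ∘ f ≈ h ∘ f → g ≈ h

  IsInitial : Obj → Set (o ⊔ ℓ ⊔ e)
  IsInitial Z = ∀ Y → Σ (Z ⇒ Y) λ u → ∀ (u' : Z ⇒ Y) → u' ≈ u

  IsPullback : ∀ {A B C' X} (f : A ⇒ B) (g : C' ⇒ B) (p₁ : X ⇒ C') (p₂ : X ⇒ A) →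
               Set (o ⊔ ℓ ⊔ e)
  IsPullback {A} {B} {C'} {X} f g p₁ p₂ =
    (f ∘ p₂ ≈ g ∘ p₁) ×
    (∀ {Y} (q₁ : Y ⇒ C') (q₂ : Y ⇒ A) → f ∘ q₂ ≈ g ∘ q₁ →
       Σ (Y ⇒ X) λ u → ((p₁ ∘ u ≈ q₁) × (p₂ ∘ u ≈ q₂)) ×
         (∀ (u' : Y ⇒ X) → p₁ ∘ u' ≈ q₁ → p₂ ∘ u' ≈ q₂ → u' ≈ u))

  IsCoproduct : {I : Set ℓ} (P : I → Obj) (X : Obj) (ι : ∀ i → P i ⇒ X) → Set (o ⊔ ℓ ⊔ e)
  IsCoproduct {I} P X ι =
    ∀ Y (f : ∀ i → P i ⇒ Y) →
      Σ (X ⇒ Y) λ u → (∀ i → u ∘ ι i ≈ f i) ×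
        (∀ (u' : X ⇒ Y) → (∀ i → u' ∘ ι i ≈ f i) → u' ≈ u)

-- (Orthogonal) factorisation systems: Q = quotients, M = embeddings

record FactorisationSystem {o ℓ e} (C : Category o ℓ e) (q : Level)
       : Set (o ⊔ ℓ ⊔ e ⊔ lsuc q) where
  private
    module C = Category C
  open C using (Obj; _⇒_; _≈_; _∘_; id)
  field
    Q : ∀ {A B} → A ⇒ B → Set q
    M : ∀ {A B} → A ⇒ B → Set q
    Q-resp-≈ : ∀ {A B} {f g : A ⇒ B} → f ≈ g → Q f → Q g
    M-resp-≈ : ∀ {A B} {f g : A ⇒ B} → f ≈ g → M f → M g
    iso⇒Q : ∀ {A B} {f : A ⇒ B} → IsIsoMor C f → Q f
    iso⇒M : ∀ {A B} {f : A ⇒ B} → IsIsoMor C f → M f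
    Q-∘ : ∀ {A B D} {f : A ⇒ B} {g : B ⇒ D} → Q f → Q g → Q (g ∘ f)
    M-∘ : ∀ {A B D} {f : A ⇒ B} {g : B ⇒ D} → M f → M g → M (g ∘ f)
    factor : ∀ {A B} (f : A ⇒ B) →
             Σ Obj λ X → Σ (A ⇒ X) λ q' → Σ (X ⇒ B) λ m →
               Q q' × M m × (m ∘ q' ≈ f)
    diagonal : ∀ {A B D E} {q' : A ⇒ B} {m : D ⇒ E} → Q q' → M m →
               (u : A ⇒ D) (v : B ⇒ E) → v ∘ q' ≈ m ∘ u →
               Σ (B ⇒ D) λ d → ((d ∘ q' ≈ u) × (m ∘ d ≈ v)) ×
                 (∀ (d' : B ⇒ D) → d' ∘ q' ≈ u → m ∘ d' ≈ v → d' ≈ d)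

module _ {o ℓ e q} {C : Category o ℓ e} (FS : FactorisationSystem C q) where
  private
    module C = Category C
  open C using (Obj; _⇒_; _≈_; _∘_; id)
  open FactorisationSystem FS

  IsProper : Set (o ⊔ ℓ ⊔ e ⊔ q)
  IsProper = (∀ {A B} (f : A ⇒ B) → Q f → Epi C f) ×
             (∀ {A B} (f : A ⇒ B) → M f → Mono C f)

  IsStable : Set (o ⊔ ℓ ⊔ e ⊔ q)
  IsStable = ∀ {A B D} (f : A ⇒ B) (m : D ⇒ B) → Q f → M m →
             Σ Obj λ X → Σ (X ⇒ D) λ p₁ → Σ (X ⇒ A) λ p₂ →
               IsPullback C f m p₁ p₂ × Q p₁

  -- embeddings into X (representatives of embedding-subobjects)
  Emb : Obj → Set (o ⊔ ℓ ⊔ q)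
  Emb X = Σ Obj λ A → Σ (A ⇒ X) M

  _≤ₛ_ : ∀ {X} → Emb X → Emb X → Set (ℓ ⊔ e)
  (A , m , _) ≤ₛ (B , n , _) = Σ (A ⇒ B) λ f → n ∘ f ≈ m

  _∼ₛ_ : ∀ {X} → Emb X → Emb X → Set (ℓ ⊔ e)
  s ∼ₛ t = (s ≤ₛ t) × (t ≤ₛ s)

  -- the poset of embedding-subobjects of X is a finite chain:
  -- finitely many (n) pairwise distinct subobjects covering all of them,
  -- and any two subobjects are comparable
  IsPath : Obj → Set (o ⊔ ℓ ⊔ e ⊔ q)
  IsPath X =
    Σ ℕ λ n → Σ (Fin n → Emb X) λ s →
      (∀ i j → s i ∼ₛ s j → i ≡ j) ×
      (∀ (t : Emb X) → Σ (Fin n) λ i → t ∼ₛ s i) ×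
      (∀ (t t' : Emb X) → (t ≤ₛ t') ⊎ (t' ≤ₛ t))

  IsWellPowered : Set (o ⊔ lsuc ℓ ⊔ e ⊔ q)
  IsWellPowered = ∀ X → Σ (Set ℓ) λ I → Σ (I → Emb X) λ s →
                    ∀ (t : Emb X) → Σ I λ i → t ∼ₛ s i

  HasPathCoproducts : Set (o ⊔ lsuc ℓ ⊔ e ⊔ q)
  HasPathCoproducts = ∀ (I : Set ℓ) (P : I → Obj) → (∀ i → IsPath (P i)) →
                      Σ Obj λ X → Σ (∀ i → P i ⇒ X) λ ι → IsCoproduct C P X ι

  -- X is connected: every morphism from X into a coproduct of a non-empty
  -- set of paths factors through a coproduct injection
  IsConnected : Obj → Set (o ⊔ lsuc ℓ ⊔ e ⊔ q)
  IsConnected X = ∀ (I : Set ℓ) (P : I → Obj) → (∀ i → IsPath (P i)) → I →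
                  ∀ Y (ι : ∀ i → P i ⇒ Y) → IsCoproduct C P Y ι →
                  ∀ (f : X ⇒ Y) → Σ I λ i → Σ (X ⇒ P i) λ h → ι i ∘ h ≈ f

  PathEmb : ∀ {p} → (Obj → Set p) → Obj → Set (o ⊔ ℓ ⊔ e ⊔ q ⊔ p)
  PathEmb S X = Σ Obj λ P → (S P × IsPath P) × Σ (P ⇒ X) M

  -- X is the colimit of its path embeddings (with domain satisfying S):
  -- the cocone of these embeddings over the diagram of path embeddings
  -- (morphisms = commuting triangles) is a colimit cocone
  IsColimOfPathEmbs : ∀ {p} → (Obj → Set p) → Obj → Set (o ⊔ ℓ ⊔ e ⊔ q ⊔ p)
  IsColimOfPathEmbs S X =
    ∀ Y (f : (x : PathEmb S X) → proj₁ x ⇒ Y) →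
      (∀ (x y : PathEmb S X) (g : proj₁ x ⇒ proj₁ y) →
         proj₁ (proj₂ (proj₂ y)) ∘ g ≈ proj₁ (proj₂ (proj₂ x)) →
         f y ∘ g ≈ f x) →
      Σ (X ⇒ Y) λ u → (∀ x → u ∘ proj₁ (proj₂ (proj₂ x)) ≈ f x) ×
        (∀ (u' : X ⇒ Y) → (∀ x → u' ∘ proj₁ (proj₂ (proj₂ x)) ≈ f x) → u' ≈ u)

  record IsArboreal : Set (o ⊔ lsuc ℓ ⊔ e ⊔ q) where
    field
      proper          : IsProper
      stable          : IsStable
      well-powered    : IsWellPowered
      path-coproducts : HasPathCoproducts
      path-colimits   : ∀ X → IsColimOfPathEmbs (λ _ → ⊤ {ℓ = o}) X
      paths-connected : ∀ P → IsPath P → IsConnected P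
      path-quotient   : ∀ {P R R'} → IsPath P → IsPath R → IsPath R' →
                        (f : P ⇒ R) (g : R ⇒ R') → Q (g ∘ f) → Q f

  record IsResourceIndexing {p} (Cp : ℕ → Obj → Set p) : Set (o ⊔ ℓ ⊔ e ⊔ q ⊔ p) where
    field
      Cp-paths    : ∀ k → 1 ≤ k → ∀ P → Cp k P → IsPath P
      Cp-chain    : ∀ k k' → 1 ≤ k → k ≤ k' → ∀ P → Cp k P → Cp k' P
      Cp-emb      : ∀ k → 1 ≤ k → ∀ {P R} (m : P ⇒ R) → M m → Cp k R → Cp k P
      Cp-initial  : ∀ k → 1 ≤ k → ∀ Z → IsInitial C Z → Cp k Z

  Ck : ∀ {p} → (ℕ → Obj → Set p) → ℕ → Category (o ⊔ ℓ ⊔ e ⊔ q ⊔ p) ℓ e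
  Ck Cp k = FullSub C (IsColimOfPathEmbs (Cp k))

record Functor {o ℓ e o' ℓ' e'} (C : Category o ℓ e) (D : Category o' ℓ' e')
       : Set (o ⊔ ℓ ⊔ e ⊔ o' ⊔ ℓ' ⊔ e') where
  private
    module C = Category C
    module D = Category D
  field
    F₀ : C.Obj → D.Obj
    F₁ : ∀ {A B} → A C.⇒ B → F₀ A D.⇒ F₀ B
    identity     : ∀ {A} → F₁ (C.id {A}) D.≈ D.id
    homomorphism : ∀ {A B X} {f : A C.⇒ B} {g : B C.⇒ X} →
                   F₁ (g C.∘ f) D.≈ F₁ g D.∘ F₁ f
    F-resp-≈     : ∀ {A B} {f g : A C.⇒ B} → f C.≈ g → F₁ f D.≈ F₁ g

record Adjunction {o ℓ e o' ℓ' e'} {C : Category o ℓ e} {D : Category o' ℓ' e'}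
       (L : Functor C D) (R : Functor D C) : Set (o ⊔ ℓ ⊔ e ⊔ o' ⊔ ℓ' ⊔ e') where
  private
    module C = Category C
    module D = Category D
    module L = Functor L
    module R = Functor R
  field
    η : ∀ X → X C.⇒ R.F₀ (L.F₀ X)
    ε : ∀ A → L.F₀ (R.F₀ A) D.⇒ A
    η-natural : ∀ {X Y} (f : X C.⇒ Y) →
                η Y C.∘ f C.≈ R.F₁ (L.F₁ f) C.∘ η X
    ε-natural : ∀ {A B} (g : A D.⇒ B) →
                ε B D.∘ L.F₁ (R.F₁ g) D.≈ g D.∘ ε A
    zig : ∀ X → ε (L.F₀ X) D.∘ L.F₁ (η X) D.≈ D.id
    zag : ∀ A → R.F₁ (ε A) C.∘ η (R.F₀ A) C.≈ C.id

  -- comultiplication of the comonad G = L R on D : δ_A = L (η_{R A})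
  δ : ∀ A → L.F₀ (R.F₀ A) D.⇒ L.F₀ (R.F₀ (L.F₀ (R.F₀ A)))
  δ A = L.F₁ (η (R.F₀ A))

  IsIdempotent : Set (o' ⊔ ℓ' ⊔ e')
  IsIdempotent = ∀ A → IsIsoMor D (δ A)

record ResourceIndexedAdjunction
       {o ℓ e q p o' ℓ' e'} {C : Category o ℓ e} (FS : FactorisationSystem C q)
       (Cp : ℕ → Category.Obj C → Set p) (E : Category o' ℓ' e')
       : Set (o ⊔ ℓ ⊔ e ⊔ q ⊔ p ⊔ o' ⊔ ℓ' ⊔ e') where
  field
    L   : ∀ k → 1 ≤ k → Functor (Ck FS Cp k) E
    R   : ∀ k → 1 ≤ k → Functor E (Ck FS Cp k)
    adj : ∀ k (k≥1 : 1 ≤ k) → Adjunction (L k k≥1) (R k k≥1)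

  IsIdempotentRI : Set (o' ⊔ ℓ' ⊔ e')
  IsIdempotentRI = ∀ k (k≥1 : 1 ≤ k) → Adjunction.IsIdempotent (adj k k≥1)

  _→[_,_]_ : Category.Obj E → ∀ k → 1 ≤ k → Category.Obj E → Set ℓ
  a →[ k , k≥1 ] b = Category._⇒_ (Ck FS Cp k) (Functor.F₀ (R k k≥1) a) (Functor.F₀ (R k k≥1) b)

  _≅[_,_]_ : Category.Obj E → ∀ k → 1 ≤ k → Category.Obj E → Set (ℓ ⊔ e)
  a ≅[ k , k≥1 ] b = Iso (Ck FS Cp k) (Functor.F₀ (R k k≥1) a) (Functor.F₀ (R k k≥1) b)

module _ {o' ℓ' e'} (E : Category o' ℓ' e') where
  ClosedUnderMorphisms : ∀ {r} → (Category.Obj E → Set r) → Set (o' ⊔ ℓ' ⊔ r)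
  ClosedUnderMorphisms D = ∀ a b → D a → Category._⇒_ E a b → D b

  ClosedUnderRel : ∀ {r s} → (Category.Obj E → Set r) →
                   (Category.Obj E → Category.Obj E → Set s) → Set (o' ⊔ r ⊔ s)
  ClosedUnderRel D ∇ = ∀ a b → D a → ∇ a b → D b

HP# : ∀ {o ℓ e q p o' ℓ' e'} {C : Category o ℓ e} {FS : FactorisationSystem C q}
      {Cp : ℕ → Category.Obj C → Set p} {E : Category o' ℓ' e'} →
      ResourceIndexedAdjunction FS Cp E → (r : Level) →
      Set (o' ⊔ ℓ' ⊔ lsuc r ⊔ ℓ ⊔ e)
HP# {E = E} A r =
  ∀ k (k≥1 : 1 ≤ k) (D : Category.Obj E → Set r) →
    ClosedUnderRel E D (λ a b → a ≅[ k , k≥1 ] b) →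
    (ClosedUnderMorphisms E D ⇔ ClosedUnderRel E D (λ a b → a →[ k , k≥1 ] b))
  where open ResourceIndexedAdjunction A

{-# OPTIONS --safe #-}
-- If the comonad L R is idempotent then η at R a is an isomorphism, so R a ≅ R (L R a), i.e.
-- a ≅_k L R a. Hence a class saturated under ≅_k and closed under morphisms contains L R a
-- whenever it contains a, and every g : R a → R b transposes to a morphism L R a → b.
-- The converse direction just applies R to a morphism. No arboreal structure is needed.
module Submission where

open import Defs
open import Level using (Level)
open import Data.Nat using (ℕ)
open import Data.Product using (_,_; proj₂)
open import Function using (_⇔_; mk⇔)
open import Relation.Binary using (Setoid; IsEquivalence)
import Relation.Binary.Reasoning.Setoid as SetoidReasoning

module HomReasoning {o ℓ e} (X : Category o ℓ e) where
  open Category X public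

  hom-setoid : Obj → Obj → Setoid ℓ e
  hom-setoid A B = record { Carrier = A ⇒ B ; _≈_ = _≈_ ; isEquivalence = equiv }

  open module Reasoning {A B} = SetoidReasoning (hom-setoid A B) public
  open module ≈ {A B} = IsEquivalence (equiv {A} {B}) public
    using () renaming (refl to ≈-refl; sym to ≈-sym; trans to ≈-trans)

  retraction-unique : ∀ {A B} {f : A ⇒ B} {s r r' : B ⇒ A} →
                      f ∘ s ≈ id → r ∘ f ≈ id → r' ∘ f ≈ id → r ≈ r'
  retraction-unique {f = f} {s} {r} {r'} fs≈id rf≈id r'f≈id = begin
    r             ≈⟨ ≈-sym identityʳ ⟩
    r ∘ id        ≈⟨ ∘-resp-≈ ≈-refl (≈-sym fs≈id) ⟩
    r ∘ (f ∘ s)   ≈⟨ ≈-sym assoc ⟩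
    (r ∘ f) ∘ s   ≈⟨ ∘-resp-≈ (≈-trans rf≈id (≈-sym r'f≈id)) ≈-refl ⟩
    (r' ∘ f) ∘ s  ≈⟨ assoc ⟩
    r' ∘ (f ∘ s)  ≈⟨ ∘-resp-≈ ≈-refl fs≈id ⟩
    r' ∘ id       ≈⟨ identityʳ ⟩
    r'            ∎

module IdempotentAdjunction
  {o ℓ e o' ℓ' e'} {C : Category o ℓ e} {E : Category o' ℓ' e'}
  {L : Functor C E} {R : Functor E C} (adj : Adjunction L R)
  (idem : Adjunction.IsIdempotent adj) where

  private
    module C = HomReasoning C
    module E = HomReasoning E
    module L = Functor L
    module R = Functor R
  open Adjunction adj

  -- Both L R ε_a and ε_{L R a} are retractions of δ_a, which is invertible.
  L-R-ε≈ε-L-R : ∀ a → L.F₁ (R.F₁ (ε a)) E.≈ ε (L.F₀ (R.F₀ a))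
  L-R-ε≈ε-L-R a = E.retraction-unique (proj₂ (proj₂ (idem a))) L-R-ε∘δ≈id (zig (R.F₀ a))
    where
    L-R-ε∘δ≈id : L.F₁ (R.F₁ (ε a)) E.∘ δ a E.≈ E.id
    L-R-ε∘δ≈id = E.begin
      L.F₁ (R.F₁ (ε a)) E.∘ L.F₁ (η (R.F₀ a))  E.≈⟨ E.≈-sym L.homomorphism ⟩
      L.F₁ (R.F₁ (ε a) C.∘ η (R.F₀ a))         E.≈⟨ L.F-resp-≈ (zag a) ⟩
      L.F₁ C.id                                E.≈⟨ L.identity ⟩
      E.id                                     E.∎

  η-R-isIso : ∀ a → IsIsoMor C (η (R.F₀ a))
  η-R-isIso a = R.F₁ (ε a) , zag a , η∘R-ε≈id
    where
    η∘R-ε≈id : η (R.F₀ a) C.∘ R.F₁ (ε a) C.≈ C.id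
    η∘R-ε≈id = C.begin
      η (R.F₀ a) C.∘ R.F₁ (ε a)                             C.≈⟨ η-natural (R.F₁ (ε a)) ⟩
      R.F₁ (L.F₁ (R.F₁ (ε a))) C.∘ η (R.F₀ (L.F₀ (R.F₀ a)))  C.≈⟨ C.∘-resp-≈ (R.F-resp-≈ (L-R-ε≈ε-L-R a)) C.≈-refl ⟩
      R.F₁ (ε (L.F₀ (R.F₀ a))) C.∘ η (R.F₀ (L.F₀ (R.F₀ a)))  C.≈⟨ zag (L.F₀ (R.F₀ a)) ⟩
      C.id                                                  C.∎

  R≅R-L-R : ∀ a → Iso C (R.F₀ a) (R.F₀ (L.F₀ (R.F₀ a)))
  R≅R-L-R a = η (R.F₀ a) , η-R-isIso a

  closedUnderMorphisms⇔closedUnderR⇒ :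
    ∀ {r} (D : Category.Obj E → Set r) →
    ClosedUnderRel E D (λ a b → Iso C (R.F₀ a) (R.F₀ b)) →
    ClosedUnderMorphisms E D ⇔ ClosedUnderRel E D (λ a b → R.F₀ a C.⇒ R.F₀ b)
  closedUnderMorphisms⇔closedUnderR⇒ D saturated = mk⇔ to from
    where
    to : ClosedUnderMorphisms E D → ClosedUnderRel E D (λ a b → R.F₀ a C.⇒ R.F₀ b)
    to closed a b Da g =
      closed (L.F₀ (R.F₀ a)) b (saturated a (L.F₀ (R.F₀ a)) Da (R≅R-L-R a)) (ε b E.∘ L.F₁ g)

    from : ClosedUnderRel E D (λ a b → R.F₀ a C.⇒ R.F₀ b) → ClosedUnderMorphisms E D
    from upwards a b Da f = upwards a b Da (R.F₁ f)

proposition4p7 : ∀ {o ℓ e q p o' ℓ' e'} (C : Category o ℓ e) (FS : FactorisationSystem C q)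
                   → IsArboreal FS
                   → (Cp : ℕ → Category.Obj C → Set p) → IsResourceIndexing FS Cp
                   → (E : Category o' ℓ' e') (A : ResourceIndexedAdjunction FS Cp E)
                   → ResourceIndexedAdjunction.IsIdempotentRI A
                   → (r : Level) → HP# A r
proposition4p7 C FS _ Cp _ E A idem r k k≥1 =
  IdempotentAdjunction.closedUnderMorphisms⇔closedUnderR⇒ (adj k k≥1) (idem k k≥1)
  where open ResourceIndexedAdjunction A
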